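{- Let $r$ be a nonzero integer and let $c(n;r)=\sum_{j\ge0}\binom{n}{j}^2r^j-\sum_{j\ge0}\binom{n+1}{j}\binom{n-1}{j}r^j$ ($n\ge0$) be the generalized Catalan numbers. Let $M=(m_{n,k})_{n,k\ge0}$ be the Riordan array $\left(\frac{1}{1+rx},\frac{x}{1+(r+1)x+rx^2}\right)$ and define $p_n(x)=\sum_{k=0}^n m_{n,k}x^k$. Then $(p_n)_{n\ge0}$ is the family of monic orthogonal polynomials associated with the Hankel matrix $\big(c(i+j;r)\big)_{i,j\ge0}$, i.e. each $p_n$ has degree $n$ and leading coefficient $1$, and $\mathcal{L}(p_mp_n)=0$ for $m\ne n$, where $\mathcal{L}$ is the linear functional on polynomials defined by $\mathcal{L}(x^k)=c(k;r)$.
   Context: A Riordan array $(g(x),f(x))$, with $g,f$ formal power series, $g(0)\neq 0$, $f(0)=0$, $f'(0)\ne0$, is the infinite lower triangular matrix whose $(n,k)$ entry ($n,k\ge0$) is the coefficient of $x^n$ in $g(x)f(x)^k$. -}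

module Defs where

open import Data.Nat using (ℕ; zero; suc; _∸_) renaming (_+_ to _+ℕ_)
open import Data.Nat.Combinatorics using (_C_)
open import Data.Integer using (ℤ; +_; _+_; _-_; _*_; -_; _^_; 0ℤ; 1ℤ)
open import Data.List using (List; []; _∷_; map; zipWith; upTo; applyUpTo; foldr; length)

sum : List ℤ → ℤ
sum = foldr _+_ 0ℤ

Σ< : ℕ → (ℕ → ℤ) → ℤ
Σ< n f = sum (applyUpTo f n)

Series : Set
Series = ℕ → ℤ

_⊛_ : Series → Series → Series
(a ⊛ b) n = Σ< (suc n) (λ i → a i * b (n ∸ i))

_^ˢ_ : Series → ℕ → Series
a ^ˢ zero = λ { zero → 1ℤ ; (suc _) → 0ℤ }
a ^ˢ suc k = a ⊛ (a ^ˢ k)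

X : Series
X (suc zero) = 1ℤ
X _ = 0ℤ

-- Multiplicative inverse 1/a of a series a with a 0 = 1 (the only case used).
-- invRev a n = [b_n , b_{n-1} , … , b_0], where b = 1/a is determined by
-- b_0 = 1 and b_{n} = - Σ_{i=1}^{n} a_i b_{n-i}.
invRev : Series → ℕ → List ℤ
invRev a zero = 1ℤ ∷ []
invRev a (suc n) =
  (- sum (zipWith _*_ (applyUpTo (λ i → a (suc i)) (suc n)) (invRev a n)))
  ∷ invRev a n

inv : Series → Series
inv a n with invRev a n
... | b ∷ _ = b
... | [] = 0ℤ

riordan : Series → Series → ℕ → ℕ → ℤ
riordan g f n k = (g ⊛ (f ^ˢ k)) n

gSer : ℤ → Series
gSer r = inv (λ { zero → 1ℤ ; (suc zero) → r ; _ → 0ℤ })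

fSer : ℤ → Series
fSer r = X ⊛ inv (λ { zero → 1ℤ ; (suc zero) → r + 1ℤ ; (suc (suc zero)) → r ; _ → 0ℤ })

M : ℤ → ℕ → ℕ → ℤ
M r = riordan (gSer r) (fSer r)

-- Polynomials over ℤ as coefficient lists (constant term first).

Poly : Set
Poly = List ℤ

coeff : Poly → ℕ → ℤ
coeff [] k = 0ℤ
coeff (a ∷ p) zero = a
coeff (a ∷ p) (suc k) = coeff p k

_·_ : Poly → Poly → Poly
p · q = applyUpTo (λ k → Σ< (suc k) (λ i → coeff p i * coeff q (k ∸ i)))
                  (length p +ℕ length q)

pPoly : ℤ → ℕ → Poly
pPoly r n = applyUpTo (M r n) (suc n)

-- Generalized Catalan numbers
-- c(n;r) = Σ_j C(n,j)² r^j − Σ_j C(n+1,j) C(n−1,j) r^j,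
-- with C(−1,j) = 0 (so the second sum vanishes for n = 0).
-- All nonzero terms have j ≤ n+1.

catalanGen : ℕ → ℤ → ℤ
catalanGen zero r = Σ< 2 (λ j → (+ (0 C j)) * (+ (0 C j)) * r ^ j)
catalanGen (suc n) r =
  Σ< (suc n +ℕ 2) (λ j → (+ (suc n C j)) * (+ (suc n C j)) * r ^ j)
  - Σ< (suc n +ℕ 2) (λ j → (+ (suc (suc n) C j)) * (+ (n C j)) * r ^ j)

L : ℤ → Poly → ℤ
L r p = Σ< (length p) (λ k → coeff p k * catalanGen k r)

module Submission where

-- Since (1 + r x) g = 1 and (1 + (r+1) x + r x²) f = x, the rows of the Riordan array satisfy
-- p₀ = 1, p₁ = x − r and p_{n+2} = (x − r − 1) p_{n+1} − r pₙ. Hence the array L(xⁱ pₙ) is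
-- determined, through the induced three-term recurrence, by its column n = 0, which is c(i;r).
-- The explicit array that is [n = 0] in row 0 and rⁿ Σₜ (C(i+1,n+t) C(i+1,t) − C(i,n+t) C(i+2,t)) rᵗ
-- in row i + 1 has the same column n = 0 and satisfies the same recurrence by Pascal's rule, and it
-- visibly vanishes for i < n. So pₙ is orthogonal to every polynomial of lower degree.

open import Defs
open import Data.Nat using (ℕ; _<_)
open import Data.Integer using (ℤ; 0ℤ; 1ℤ)
open import Data.Product using (_×_)
open import Relation.Binary.PropositionalEquality using (_≡_; _≢_)

import Data.Integer.Properties as ℤ
open import Algebra.Properties.AbelianGroup ℤ.+-0-abelianGroup using (inverseˡ-unique)
open import Algebra.Properties.CommutativeSemigroup ℤ.+-commutativeSemigroup using (interchange)
open import Data.Integer using (_+_; _-_; _*_; -_; _^_)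
open import Data.Integer.Tactic.RingSolver using (solve-∀; solve)
open import Data.List using ([]; _∷_; applyUpTo; zipWith; length)
import Data.List.Properties as List
open import Data.Nat using (zero; suc; _≤_; z≤n; s≤s; z<s; _∸_) renaming (_+_ to _+ℕ_)
open import Data.Nat.Combinatorics using (_C_; nCk+nC[k+1]≡[n+1]C[k+1]; k>n⇒nCk≡0)
import Data.Nat.Properties as ℕ
open import Data.Product using (_,_; proj₁; proj₂)
open import Relation.Binary.Definitions using (tri<; tri≈; tri>)
open import Relation.Binary.PropositionalEquality
  using (_≗_; refl; sym; trans; cong; cong₂; module ≡-Reasoning)
open import Relation.Nullary using (yes; no; contradiction)

-- Finite sums

Σ<-cong : ∀ n {f g : ℕ → ℤ} → (∀ i → i < n → f i ≡ g i) → Σ< n f ≡ Σ< n g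
Σ<-cong zero    f≡g = refl
Σ<-cong (suc n) f≡g = cong₂ _+_ (f≡g 0 z<s) (Σ<-cong n (λ i i<n → f≡g (suc i) (s≤s i<n)))

Σ<-zero : ∀ n {f : ℕ → ℤ} → (∀ i → i < n → f i ≡ 0ℤ) → Σ< n f ≡ 0ℤ
Σ<-zero zero    f≡0 = refl
Σ<-zero (suc n) f≡0 = cong₂ _+_ (f≡0 0 z<s) (Σ<-zero n (λ i i<n → f≡0 (suc i) (s≤s i<n)))

Σ<-distrib-+ : ∀ n (f g : ℕ → ℤ) → Σ< n (λ i → f i + g i) ≡ Σ< n f + Σ< n g
Σ<-distrib-+ zero    f g = refl
Σ<-distrib-+ (suc n) f g = begin
  (f 0 + g 0) + Σ< n (λ i → f (suc i) + g (suc i))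
    ≡⟨ cong ((f 0 + g 0) +_) (Σ<-distrib-+ n (λ i → f (suc i)) (λ i → g (suc i))) ⟩
  (f 0 + g 0) + (Σ< n (λ i → f (suc i)) + Σ< n (λ i → g (suc i)))
    ≡⟨ interchange (f 0) (g 0) _ _ ⟩
  (f 0 + Σ< n (λ i → f (suc i))) + (g 0 + Σ< n (λ i → g (suc i))) ∎
  where open ≡-Reasoning

Σ<-distribˡ-* : ∀ n (c : ℤ) (f : ℕ → ℤ) → Σ< n (λ i → c * f i) ≡ c * Σ< n f
Σ<-distribˡ-* zero    c f = sym (ℤ.*-zeroʳ c)
Σ<-distribˡ-* (suc n) c f = trans (cong (c * f 0 +_) (Σ<-distribˡ-* n c (λ i → f (suc i))))
                                  (sym (ℤ.*-distribˡ-+ c (f 0) _))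

Σ<-distrib-- : ∀ n (f g : ℕ → ℤ) → Σ< n (λ i → f i - g i) ≡ Σ< n f - Σ< n g
Σ<-distrib-- zero    f g = refl
Σ<-distrib-- (suc n) f g =
  trans (cong ((f 0 - g 0) +_) (Σ<-distrib-- n (λ i → f (suc i)) (λ i → g (suc i))))
        (regroup (f 0) (g 0) _ _)
  where
  regroup : ∀ a b c d → (a - b) + (c - d) ≡ (a + c) - (b + d)
  regroup = solve-∀

Σ<-distribʳ-* : ∀ n (f : ℕ → ℤ) (c : ℤ) → Σ< n (λ i → f i * c) ≡ Σ< n f * c
Σ<-distribʳ-* n f c = begin
  Σ< n (λ i → f i * c)  ≡⟨ Σ<-cong n (λ i _ → ℤ.*-comm (f i) c) ⟩
  Σ< n (λ i → c * f i)  ≡⟨ Σ<-distribˡ-* n c f ⟩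
  c * Σ< n f            ≡⟨ ℤ.*-comm c _ ⟩
  Σ< n f * c            ∎
  where open ≡-Reasoning

Σ<-suc : ∀ n (f : ℕ → ℤ) → Σ< (suc n) f ≡ Σ< n f + f n
Σ<-suc zero    f = trans (ℤ.+-identityʳ (f 0)) (sym (ℤ.+-identityˡ (f 0)))
Σ<-suc (suc n) f = trans (cong (f 0 +_) (Σ<-suc n (λ i → f (suc i))))
                         (sym (ℤ.+-assoc (f 0) _ (f (suc n))))

Σ<-extend : ∀ {m n} (f : ℕ → ℤ) → (∀ i → m ≤ i → f i ≡ 0ℤ) → m ≤ n → Σ< n f ≡ Σ< m f
Σ<-extend {zero}  {n}     f f≡0 _         = Σ<-zero n (λ i _ → f≡0 i z≤n)
Σ<-extend {suc m} {suc n} f f≡0 (s≤s m≤n) =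
  cong (f 0 +_) (Σ<-extend (λ i → f (suc i)) (λ i m≤i → f≡0 (suc i) (s≤s m≤i)) m≤n)

Σ<-triangle : ∀ N (F : ℕ → ℕ → ℤ) →
  Σ< N (λ k → Σ< (suc k) (λ i → F i (k ∸ i))) ≡ Σ< N (λ i → Σ< (N ∸ i) (F i))
Σ<-triangle zero    F = refl
Σ<-triangle (suc N) F = begin
  (F 0 0 + 0ℤ) + Σ< N (λ k → F 0 (suc k) + Σ< (suc k) (λ i → F (suc i) (k ∸ i)))
    ≡⟨ cong ((F 0 0 + 0ℤ) +_) (Σ<-distrib-+ N (λ k → F 0 (suc k)) _) ⟩
  (F 0 0 + 0ℤ) + (Σ< N (λ k → F 0 (suc k)) + Σ< N (λ k → Σ< (suc k) (λ i → F (suc i) (k ∸ i))))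
    ≡⟨ cong (λ z → (F 0 0 + 0ℤ) + (Σ< N (λ k → F 0 (suc k)) + z)) (Σ<-triangle N (λ i → F (suc i))) ⟩
  (F 0 0 + 0ℤ) + (Σ< N (λ k → F 0 (suc k)) + Σ< N (λ i → Σ< (N ∸ i) (F (suc i))))
    ≡⟨ regroup (F 0 0) _ _ ⟩
  (F 0 0 + Σ< N (λ k → F 0 (suc k))) + Σ< N (λ i → Σ< (N ∸ i) (F (suc i))) ∎
  where
  open ≡-Reasoning
  regroup : ∀ x y z → (x + 0ℤ) + (y + z) ≡ (x + y) + z
  regroup = solve-∀

-- Formal power series

1ˢ : Series
1ˢ zero    = 1ℤ
1ˢ (suc _) = 0ℤ

_+ˢ_ : Series → Series → Series
(a +ˢ b) n = a n + b n

shift : Series → Series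
shift a n = a (suc n)

mulX : Series → Series
mulX a zero    = 0ℤ
mulX a (suc n) = a n

⊛-congˡ : ∀ {a a′} b → a ≗ a′ → (a ⊛ b) ≗ (a′ ⊛ b)
⊛-congˡ b a≗a′ n = Σ<-cong (suc n) (λ i _ → cong (_* b (n ∸ i)) (a≗a′ i))

⊛-congʳ : ∀ a {b b′} → b ≗ b′ → (a ⊛ b) ≗ (a ⊛ b′)
⊛-congʳ a b≗b′ n = Σ<-cong (suc n) (λ i _ → cong (a i *_) (b≗b′ (n ∸ i)))

⊛-suc : ∀ a b n → (a ⊛ b) (suc n) ≡ (a ⊛ shift b) n + a (suc n) * b 0
⊛-suc a b n = trans (Σ<-suc (suc n) (λ i → a i * b (suc n ∸ i)))
  (cong₂ _+_ (Σ<-cong (suc n) (λ i i<1+n → cong (λ j → a i * b j) (ℕ.+-∸-assoc 1 (ℕ.≤-pred i<1+n))))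
             (cong (λ j → a (suc n) * b j) (ℕ.n∸n≡0 n)))

⊛-comm : ∀ a b → (a ⊛ b) ≗ (b ⊛ a)
⊛-comm a b zero    = cong (_+ 0ℤ) (ℤ.*-comm (a 0) (b 0))
⊛-comm a b (suc n) = begin
  a 0 * b (suc n) + (shift a ⊛ b) n  ≡⟨ cong (a 0 * b (suc n) +_) (⊛-comm (shift a) b n) ⟩
  a 0 * b (suc n) + (b ⊛ shift a) n  ≡⟨ ℤ.+-comm (a 0 * b (suc n)) _ ⟩
  (b ⊛ shift a) n + a 0 * b (suc n)  ≡⟨ cong ((b ⊛ shift a) n +_) (ℤ.*-comm (a 0) (b (suc n))) ⟩
  (b ⊛ shift a) n + b (suc n) * a 0  ≡⟨ sym (⊛-suc b a n) ⟩
  (b ⊛ a) (suc n)                    ∎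
  where open ≡-Reasoning

⊛-linearˡ : ∀ (x : ℤ) u v c n → ((λ k → x * u k + v k) ⊛ c) n ≡ x * (u ⊛ c) n + (v ⊛ c) n
⊛-linearˡ x u v c n = begin
  Σ< (suc n) (λ i → (x * u i + v i) * c (n ∸ i))
    ≡⟨ Σ<-cong (suc n) (λ i _ → distrib x (u i) (v i) (c (n ∸ i))) ⟩
  Σ< (suc n) (λ i → x * (u i * c (n ∸ i)) + v i * c (n ∸ i))
    ≡⟨ Σ<-distrib-+ (suc n) (λ i → x * (u i * c (n ∸ i))) (λ i → v i * c (n ∸ i)) ⟩
  Σ< (suc n) (λ i → x * (u i * c (n ∸ i))) + (v ⊛ c) n
    ≡⟨ cong (_+ (v ⊛ c) n) (Σ<-distribˡ-* (suc n) x (λ i → u i * c (n ∸ i))) ⟩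
  x * (u ⊛ c) n + (v ⊛ c) n ∎
  where
  open ≡-Reasoning
  distrib : ∀ x u v c → (x * u + v) * c ≡ x * (u * c) + v * c
  distrib = solve-∀

⊛-assoc : ∀ a b c → ((a ⊛ b) ⊛ c) ≗ (a ⊛ (b ⊛ c))
⊛-assoc a b c zero    = assoc₀ (a 0) (b 0) (c 0)
  where
  assoc₀ : ∀ x y z → (x * y + 0ℤ) * z + 0ℤ ≡ x * (y * z + 0ℤ) + 0ℤ
  assoc₀ = solve-∀
⊛-assoc a b c (suc n) = begin
  (a 0 * b 0 + 0ℤ) * c (suc n) + (shift (a ⊛ b) ⊛ c) n
    ≡⟨ cong ((a 0 * b 0 + 0ℤ) * c (suc n) +_) (⊛-linearˡ (a 0) (shift b) (shift a ⊛ b) c n) ⟩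
  (a 0 * b 0 + 0ℤ) * c (suc n) + (a 0 * (shift b ⊛ c) n + ((shift a ⊛ b) ⊛ c) n)
    ≡⟨ cong (λ z → (a 0 * b 0 + 0ℤ) * c (suc n) + (a 0 * (shift b ⊛ c) n + z)) (⊛-assoc (shift a) b c n) ⟩
  (a 0 * b 0 + 0ℤ) * c (suc n) + (a 0 * (shift b ⊛ c) n + (shift a ⊛ (b ⊛ c)) n)
    ≡⟨ regroup (a 0) (b 0) (c (suc n)) _ _ ⟩
  a 0 * (b 0 * c (suc n) + (shift b ⊛ c) n) + (shift a ⊛ (b ⊛ c)) n ∎
  where
  open ≡-Reasoning
  regroup : ∀ x y z u v → (x * y + 0ℤ) * z + (x * u + v) ≡ x * (y * z + u) + v
  regroup = solve-∀

⊛-swap : ∀ a b c → (a ⊛ (b ⊛ c)) ≗ (b ⊛ (a ⊛ c))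
⊛-swap a b c n = begin
  (a ⊛ (b ⊛ c)) n  ≡⟨ sym (⊛-assoc a b c n) ⟩
  ((a ⊛ b) ⊛ c) n  ≡⟨ ⊛-congˡ c (⊛-comm a b) n ⟩
  ((b ⊛ a) ⊛ c) n  ≡⟨ ⊛-assoc b a c n ⟩
  (b ⊛ (a ⊛ c)) n  ∎
  where open ≡-Reasoning

⊛-identityˡ : ∀ b → (1ˢ ⊛ b) ≗ b
⊛-identityˡ b n = trans (cong (1ℤ * b n +_) (Σ<-zero n (λ _ _ → refl)))
                        (trans (ℤ.+-identityʳ _) (ℤ.*-identityˡ (b n)))

⊛-identityʳ : ∀ b → (b ⊛ 1ˢ) ≗ b
⊛-identityʳ b n = trans (⊛-comm b 1ˢ n) (⊛-identityˡ b n)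

X⊛-suc : ∀ u n → (X ⊛ u) (suc n) ≡ u n
X⊛-suc u n = trans (ℤ.+-identityˡ _) (trans (⊛-congˡ u shiftX≗1 n) (⊛-identityˡ u n))
  where
  shiftX≗1 : shift X ≗ 1ˢ
  shiftX≗1 zero    = refl
  shiftX≗1 (suc _) = refl

zipWith-applyUpTo : ∀ {A B C : Set} (_∙_ : A → B → C) f g n →
  zipWith _∙_ (applyUpTo f n) (applyUpTo g n) ≡ applyUpTo (λ i → f i ∙ g i) n
zipWith-applyUpTo _∙_ f g zero    = refl
zipWith-applyUpTo _∙_ f g (suc n) =
  cong (f 0 ∙ g 0 ∷_) (zipWith-applyUpTo _∙_ (λ i → f (suc i)) (λ i → g (suc i)) n)

invRev≡applyUpTo : ∀ a n → invRev a n ≡ applyUpTo (λ k → inv a (n ∸ k)) (suc n)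
invRev≡applyUpTo a zero    = refl
invRev≡applyUpTo a (suc n) = cong (inv a (suc n) ∷_) (invRev≡applyUpTo a n)

inv-suc : ∀ a n → inv a (suc n) ≡ - (shift a ⊛ inv a) n
inv-suc a n = cong (λ l → - sum l)
  (trans (cong (zipWith _*_ (applyUpTo (shift a) (suc n))) (invRev≡applyUpTo a n))
         (zipWith-applyUpTo _*_ (shift a) (λ k → inv a (n ∸ k)) (suc n)))

⊛-inverseʳ : ∀ a → a 0 ≡ 1ℤ → (a ⊛ inv a) ≗ 1ˢ
⊛-inverseʳ a a₀≡1 zero    rewrite a₀≡1 = refl
⊛-inverseʳ a a₀≡1 (suc n) rewrite a₀≡1 =
  trans (cong (λ z → 1ℤ * z + (shift a ⊛ inv a) n) (inv-suc a n)) (cancel ((shift a ⊛ inv a) n))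
  where
  cancel : ∀ s → 1ℤ * (- s) + s ≡ 0ℤ
  cancel = solve-∀

VanishesBelow : ℕ → Series → Set
VanishesBelow p a = ∀ i → i < p → a i ≡ 0ℤ

⊛-vanishesBelow : ∀ p q a b → VanishesBelow p a → VanishesBelow q b → VanishesBelow (p +ℕ q) (a ⊛ b)
⊛-vanishesBelow zero    q a b _ b≡0 n n<q = Σ<-zero (suc n) (λ i _ →
  trans (cong (a i *_) (b≡0 (n ∸ i) (ℕ.≤-<-trans (ℕ.m∸n≤m n i) n<q))) (ℤ.*-zeroʳ (a i)))
⊛-vanishesBelow (suc p) q a b a≡0 b≡0 zero    _ = cong (λ z → z * b 0 + 0ℤ) (a≡0 0 z<s)
⊛-vanishesBelow (suc p) q a b a≡0 b≡0 (suc n) (s≤s n<p+q) =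
  cong₂ _+_ (cong (_* b (suc n)) (a≡0 0 z<s))
            (⊛-vanishesBelow p q (shift a) b (λ i i<p → a≡0 (suc i) (s≤s i<p)) b≡0 n n<p+q)

⊛-leading : ∀ p q a b → VanishesBelow p a → VanishesBelow q b → (a ⊛ b) (p +ℕ q) ≡ a p * b q
⊛-leading zero    q a b _ b≡0 = trans (cong (a 0 * b q +_) (Σ<-zero q (λ i i<q →
  trans (cong (a (suc i) *_) (b≡0 (q ∸ suc i) (ℕ.∸-monoʳ-< z<s i<q))) (ℤ.*-zeroʳ (a (suc i))))))
  (ℤ.+-identityʳ _)
⊛-leading (suc p) q a b a≡0 b≡0 =
  trans (cong (λ z → z * b (suc (p +ℕ q)) + (shift a ⊛ b) (p +ℕ q)) (a≡0 0 z<s))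
        (trans (ℤ.+-identityˡ _) (⊛-leading p q (shift a) b (λ i i<p → a≡0 (suc i) (s≤s i<p)) b≡0))

vanishesBelow-1 : ∀ {a} → a 0 ≡ 0ℤ → VanishesBelow 1 a
vanishesBelow-1 a₀≡0 zero    _         = a₀≡0
vanishesBelow-1 a₀≡0 (suc _) (s≤s ())

^ˢ-vanishesBelow : ∀ {f} → f 0 ≡ 0ℤ → ∀ k → VanishesBelow k (f ^ˢ k)
^ˢ-vanishesBelow f₀≡0 zero    _ ()
^ˢ-vanishesBelow {f} f₀≡0 (suc k) = ⊛-vanishesBelow 1 k f (f ^ˢ k) (vanishesBelow-1 f₀≡0) (^ˢ-vanishesBelow f₀≡0 k)

^ˢ-leading : ∀ {f} → f 0 ≡ 0ℤ → ∀ k → (f ^ˢ k) k ≡ f 1 ^ k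
^ˢ-leading f₀≡0 zero    = refl
^ˢ-leading {f} f₀≡0 (suc k) = trans (⊛-leading 1 k f (f ^ˢ k) (vanishesBelow-1 f₀≡0) (^ˢ-vanishesBelow f₀≡0 k))
                                    (cong (f 1 *_) (^ˢ-leading f₀≡0 k))

-- Riordan arrays

riordan-lowerTriangular : ∀ g {f} → f 0 ≡ 0ℤ → ∀ {n k} → n < k → riordan g f n k ≡ 0ℤ
riordan-lowerTriangular g {f} f₀≡0 {n} {k} = ⊛-vanishesBelow 0 k g (f ^ˢ k) (λ _ ()) (^ˢ-vanishesBelow f₀≡0 k) n

riordan-diagonal : ∀ g {f} → f 0 ≡ 0ℤ → ∀ n → riordan g f n n ≡ g 0 * f 1 ^ n
riordan-diagonal g {f} f₀≡0 n = trans (⊛-leading 0 n g (f ^ˢ n) (λ _ ()) (^ˢ-vanishesBelow f₀≡0 n))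
                                      (cong (g 0 *_) (^ˢ-leading f₀≡0 n))

riordan-column-zero : ∀ g f → (λ n → riordan g f n 0) ≗ g
riordan-column-zero g f n = trans (⊛-congʳ g f⁰≗1 n) (⊛-identityʳ g n)
  where
  f⁰≗1 : f ^ˢ 0 ≗ 1ˢ
  f⁰≗1 zero    = refl
  f⁰≗1 (suc _) = refl

riordan-column-suc : ∀ a g f → (a ⊛ f) ≗ X → ∀ k →
  (a ⊛ (λ n → riordan g f n (suc k))) ≗ (X ⊛ (λ n → riordan g f n k))
riordan-column-suc a g f a⊛f≗X k n = begin
  (a ⊛ (g ⊛ (f ⊛ (f ^ˢ k)))) n    ≡⟨ ⊛-swap a g (f ⊛ (f ^ˢ k)) n ⟩
  (g ⊛ (a ⊛ (f ⊛ (f ^ˢ k)))) n    ≡⟨ ⊛-congʳ g (λ m → sym (⊛-assoc a f (f ^ˢ k) m)) n ⟩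
  (g ⊛ ((a ⊛ f) ⊛ (f ^ˢ k))) n    ≡⟨ ⊛-congʳ g (⊛-congˡ (f ^ˢ k) a⊛f≗X) n ⟩
  (g ⊛ (X ⊛ (f ^ˢ k))) n          ≡⟨ ⊛-swap g X (f ^ˢ k) n ⟩
  (X ⊛ (g ⊛ (f ^ˢ k))) n          ∎
  where open ≡-Reasoning

-- gSer and fSer are built from anonymous pattern lambdas, which can only be identified with these
-- denominators pointwise; hence the ≗ hypotheses below.
gDen : ℤ → Series
gDen r zero          = 1ℤ
gDen r (suc zero)    = r
gDen r (suc (suc _)) = 0ℤ

fDen : ℤ → Series
fDen r zero                = 1ℤ
fDen r (suc zero)          = r + 1ℤ
fDen r (suc (suc zero))    = r
fDen r (suc (suc (suc _))) = 0ℤ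

⊛-inverseʳ-≗ : ∀ {a} b → a ≗ b → b 0 ≡ 1ℤ → (b ⊛ inv a) ≗ 1ˢ
⊛-inverseʳ-≗ {a} b a≗b b₀≡1 n =
  trans (⊛-congˡ (inv a) (λ i → sym (a≗b i)) n) (⊛-inverseʳ a (trans (a≗b 0) b₀≡1) n)

gDen-⊛-gSer : ∀ r → (gDen r ⊛ gSer r) ≗ 1ˢ
gDen-⊛-gSer r = ⊛-inverseʳ-≗ (gDen r) (λ { zero → refl ; (suc zero) → refl ; (suc (suc _)) → refl }) refl

⊛-X⊛-inverse-≗ : ∀ {a} b → a ≗ b → b 0 ≡ 1ℤ → (b ⊛ (X ⊛ inv a)) ≗ X
⊛-X⊛-inverse-≗ {a} b a≗b b₀≡1 n = begin
  (b ⊛ (X ⊛ inv a)) n  ≡⟨ ⊛-swap b X (inv a) n ⟩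
  (X ⊛ (b ⊛ inv a)) n  ≡⟨ ⊛-congʳ X (⊛-inverseʳ-≗ b a≗b b₀≡1) n ⟩
  (X ⊛ 1ˢ) n           ≡⟨ ⊛-identityʳ X n ⟩
  X n                  ∎
  where open ≡-Reasoning

fDen-⊛-fSer : ∀ r → (fDen r ⊛ fSer r) ≗ X
fDen-⊛-fSer r = ⊛-X⊛-inverse-≗ (fDen r)
  (λ { zero → refl ; (suc zero) → refl ; (suc (suc zero)) → refl ; (suc (suc (suc _))) → refl }) refl

gDen-⊛-suc : ∀ r u n → (gDen r ⊛ u) (suc n) ≡ u (suc n) + r * u n
gDen-⊛-suc r u n = cong₂ _+_ (ℤ.*-identityˡ (u (suc n)))
  (trans (cong (r * u n +_) (Σ<-zero n (λ _ _ → refl))) (ℤ.+-identityʳ (r * u n)))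

fDen-⊛-one : ∀ r u → (fDen r ⊛ u) 1 ≡ u 1 + (r + 1ℤ) * u 0
fDen-⊛-one r u = cong₂ _+_ (ℤ.*-identityˡ (u 1)) (ℤ.+-identityʳ _)

fDen-⊛-suc-suc : ∀ r u n → (fDen r ⊛ u) (suc (suc n)) ≡ u (suc (suc n)) + (r + 1ℤ) * u (suc n) + r * u n
fDen-⊛-suc-suc r u n = trans
  (cong₂ _+_ (ℤ.*-identityˡ (u (suc (suc n))))
    (cong ((r + 1ℤ) * u (suc n) +_) (trans (cong (r * u n +_) (Σ<-zero n (λ _ _ → refl))) (ℤ.+-identityʳ _))))
  (sym (ℤ.+-assoc (u (suc (suc n))) _ _))

gSer-suc : ∀ r n → gSer r (suc n) ≡ - (r * gSer r n)
gSer-suc r n = inverseˡ-unique _ _ (trans (sym (gDen-⊛-suc r (gSer r) n)) (gDen-⊛-gSer r (suc n)))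

-- Binomial coefficients

choose : ℕ → ℕ → ℤ
choose n k = Data.Integer.+ (n C k)

choose-suc-suc : ∀ n k → choose (suc n) (suc k) ≡ choose n k + choose n (suc k)
choose-suc-suc n k = cong Data.Integer.+_ (sym (nCk+nC[k+1]≡[n+1]C[k+1] n k))

choose-> : ∀ {n k} → n < k → choose n k ≡ 0ℤ
choose-> n<k = cong Data.Integer.+_ (k>n⇒nCk≡0 n<k)

G : ℕ → ℕ → Series
G i n t = choose (suc i) (n +ℕ t) * choose (suc i) t - choose i (n +ℕ t) * choose (2 +ℕ i) t

G-suc-zero : ∀ i → G (suc i) 0 ≗ mulX (G i 0 +ˢ G i 1)
G-suc-zero i zero    = refl
G-suc-zero i (suc s) = identity (choose i s) (choose i (suc s)) (choose (suc i) s) (choose (2 +ℕ i) s)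
  (choose-suc-suc i s) (choose-suc-suc (suc i) s) (choose-suc-suc (2 +ℕ i) s)
  where
  identity : ∀ a₀ a₁ b₀ d₀ {b₁ d₁ e₁} → b₁ ≡ a₀ + a₁ → d₁ ≡ b₀ + b₁ → e₁ ≡ d₀ + d₁ →
    d₁ * d₁ - b₁ * e₁ ≡ (b₀ * b₀ - a₀ * d₀) + (b₁ * b₀ - a₁ * d₀)
  identity a₀ a₁ b₀ d₀ refl refl refl = solve (a₀ ∷ a₁ ∷ b₀ ∷ d₀ ∷ [])

G-suc-suc : ∀ i n → G (suc i) (suc n) ≗ (G i n +ˢ G i (suc n)) +ˢ mulX (G i (suc n) +ˢ G i (2 +ℕ n))
G-suc-suc i n zero rewrite ℕ.+-identityʳ n =
  identity (choose i n) (choose i (suc n)) (choose (suc i) n) (choose-suc-suc i n) (choose-suc-suc (suc i) n)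
  where
  identity : ∀ a₀ a₁ b₀ {b₁ d₁} → b₁ ≡ a₀ + a₁ → d₁ ≡ b₀ + b₁ →
    d₁ * 1ℤ - b₁ * 1ℤ ≡ ((b₀ * 1ℤ - a₀ * 1ℤ) + (b₁ * 1ℤ - a₁ * 1ℤ)) + 0ℤ
  identity a₀ a₁ b₀ refl refl = solve (a₀ ∷ a₁ ∷ b₀ ∷ [])
G-suc-suc i n (suc s) rewrite ℕ.+-suc n s =
  identity (choose i (suc (n +ℕ s))) (choose i (2 +ℕ (n +ℕ s))) (choose (suc i) (suc (n +ℕ s)))
           (choose (suc i) s) (choose (suc i) (suc s)) (choose (2 +ℕ i) s)
           (choose-suc-suc i (suc (n +ℕ s))) (choose-suc-suc (suc i) (suc (n +ℕ s)))
           (choose-suc-suc (suc i) s) (choose-suc-suc (2 +ℕ i) s)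
  where
  identity : ∀ a₁ a₂ b₁ β₀ β₁ δ₀ {b₂ d₂ δ₁ ε₁} →
    b₂ ≡ a₁ + a₂ → d₂ ≡ b₁ + b₂ → δ₁ ≡ β₀ + β₁ → ε₁ ≡ δ₀ + δ₁ →
    d₂ * δ₁ - b₂ * ε₁ ≡ ((b₁ * β₁ - a₁ * δ₁) + (b₂ * β₁ - a₂ * δ₁)) + ((b₁ * β₀ - a₁ * δ₀) + (b₂ * β₀ - a₂ * δ₀))
  identity a₁ a₂ b₁ β₀ β₁ δ₀ refl refl refl refl = solve (a₁ ∷ a₂ ∷ b₁ ∷ β₀ ∷ β₁ ∷ δ₀ ∷ [])

G-degree : ∀ i n {t} → 2 +ℕ i < t → G i n t ≡ 0ℤ
G-degree i n {t} 2+i<t = trans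
  (cong₂ (λ x y → choose (suc i) (n +ℕ t) * x - choose i (n +ℕ t) * y)
         (choose-> (ℕ.<-trans (ℕ.n<1+n _) 2+i<t)) (choose-> 2+i<t))
  (cong₂ _-_ (ℤ.*-zeroʳ (choose (suc i) (n +ℕ t))) (ℤ.*-zeroʳ (choose i (n +ℕ t))))

G-vanishes : ∀ {i n} → suc i < n → ∀ t → G i n t ≡ 0ℤ
G-vanishes {i} {n} 1+i<n t = cong₂ (λ x y → x * choose (suc i) t - y * choose (2 +ℕ i) t)
  (choose-> 1+i<n+t) (choose-> (ℕ.<-trans (ℕ.n<1+n i) 1+i<n+t))
  where
  1+i<n+t : suc i < n +ℕ t
  1+i<n+t = ℕ.<-≤-trans 1+i<n (ℕ.m≤m+n n t)

coeff-applyUpTo : ∀ (f : ℕ → ℤ) {n k} → k < n → coeff (applyUpTo f n) k ≡ f k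
coeff-applyUpTo f {suc n} {zero}  _         = refl
coeff-applyUpTo f {suc n} {suc k} (s≤s k<n) = coeff-applyUpTo (λ i → f (suc i)) k<n

coeff-applyUpTo-≥ : ∀ (f : ℕ → ℤ) {n k} → n ≤ k → coeff (applyUpTo f n) k ≡ 0ℤ
coeff-applyUpTo-≥ f {zero}              _         = refl
coeff-applyUpTo-≥ f {suc n} {suc k} (s≤s n≤k) = coeff-applyUpTo-≥ (λ i → f (suc i)) n≤k

length-· : ∀ p q → length (p · q) ≡ length p +ℕ length q
length-· p q = List.length-applyUpTo _ (length p +ℕ length q)

coeff-· : ∀ p q {k} → k < length p +ℕ length q → coeff (p · q) k ≡ (coeff p ⊛ coeff q) k
coeff-· p q = coeff-applyUpTo (λ k → (coeff p ⊛ coeff q) k)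

-- The array M and the moments of its rows

module _ (r : ℤ) where

  M-lowerTriangular : ∀ {n k} → n < k → M r n k ≡ 0ℤ
  M-lowerTriangular = riordan-lowerTriangular (gSer r) refl

  M-diagonal : ∀ n → M r n n ≡ 1ℤ
  M-diagonal n = trans (riordan-diagonal (gSer r) refl n) (trans (ℤ.*-identityˡ _) (ℤ.^-zeroˡ n))

  M-column-zero : ∀ n → M r n 0 ≡ gSer r n
  M-column-zero = riordan-column-zero (gSer r) (fSer r)

  M-column-suc : ∀ k n → (fDen r ⊛ (λ m → M r m (suc k))) (suc n) ≡ M r n k
  M-column-suc k n = trans (riordan-column-suc (fDen r) (gSer r) (fSer r) (fDen-⊛-fSer r) k (suc n))
                           (X⊛-suc (λ m → M r m k) n)

  M-row-one : ∀ j → M r 1 j ≡ mulX (M r 0) j - r * M r 0 j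
  M-row-one zero    = trans (M-column-zero 1) (trans (gSer-suc r 0) (sym (ℤ.+-identityˡ _)))
  M-row-one (suc k) = isolate (M-lowerTriangular {0} {suc k} z<s)
    (trans (sym (fDen-⊛-one r (λ m → M r m (suc k)))) (M-column-suc k 0))
    where
    isolate : ∀ {x y w} → y ≡ 0ℤ → x + (r + 1ℤ) * y ≡ w → x ≡ w - r * y
    isolate {x} refl refl = identity x r
      where
      identity : ∀ x r → x ≡ x + (r + 1ℤ) * 0ℤ - r * 0ℤ
      identity = solve-∀

  M-row-suc-suc : ∀ n j → M r (suc (suc n)) j ≡ mulX (M r (suc n)) j - (r + 1ℤ) * M r (suc n) j - r * M r n j
  M-row-suc-suc n zero
    rewrite M-column-zero n | M-column-zero (suc n) | M-column-zero (suc (suc n))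
          | gSer-suc r (suc n) | gSer-suc r n = second-order (gSer r n) r
    where
    second-order : ∀ g r → - (r * - (r * g)) ≡ 0ℤ - (r + 1ℤ) * - (r * g) - r * g
    second-order = solve-∀
  M-row-suc-suc n (suc k) = isolate
    (trans (sym (fDen-⊛-suc-suc r (λ m → M r m (suc k)) n)) (M-column-suc k (suc n)))
    where
    isolate : ∀ {x y z w} → x + y + z ≡ w → x ≡ w - y - z
    isolate {x} {y} {z} refl = identity x y z
      where
      identity : ∀ x y z → x ≡ x + y + z - y - z
      identity = solve-∀

  c : ℕ → ℤ
  c k = catalanGen k r

  -- ℓ i p B = L(xⁱ p) for the polynomial p with coefficients p 0, …, p (B ∸ 1).
  ℓ : ℕ → Series → ℕ → ℤ
  ℓ i p B = Σ< B (λ j → p j * c (i +ℕ j))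

  ℓ-mulX : ∀ i p B → ℓ i (mulX p) (suc B) ≡ ℓ (suc i) p B
  ℓ-mulX i p B = trans (ℤ.+-identityˡ _) (Σ<-cong B (λ j _ → cong (λ m → p j * c m) (ℕ.+-suc i j)))

  ℓ-linear : ∀ i B u v α {p} → p ≗ (λ j → u j - α * v j) → ℓ i p B ≡ ℓ i u B - α * ℓ i v B
  ℓ-linear i B u v α {p} p≗u-αv = begin
    Σ< B (λ j → p j * c (i +ℕ j))
      ≡⟨ Σ<-cong B (λ j _ → trans (cong (_* c (i +ℕ j)) (p≗u-αv j)) (distrib α (u j) (v j) (c (i +ℕ j)))) ⟩
    Σ< B (λ j → u j * c (i +ℕ j) - α * (v j * c (i +ℕ j)))
      ≡⟨ Σ<-distrib-- B _ _ ⟩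
    ℓ i u B - Σ< B (λ j → α * (v j * c (i +ℕ j)))
      ≡⟨ cong (λ z → ℓ i u B - z) (Σ<-distribˡ-* B α _) ⟩
    ℓ i u B - α * ℓ i v B ∎
    where
    open ≡-Reasoning
    distrib : ∀ a x y z → (x - a * y) * z ≡ x * z - a * (y * z)
    distrib = solve-∀

  ℓ-extend : ∀ i p {b B} → (∀ j → b ≤ j → p j ≡ 0ℤ) → b ≤ B → ℓ i p B ≡ ℓ i p b
  ℓ-extend i p p≡0 = Σ<-extend (λ j → p j * c (i +ℕ j)) (λ j b≤j → cong (_* c (i +ℕ j)) (p≡0 j b≤j))

  -- Lxp i n = L(xⁱ pₙ).
  Lxp : ℕ → ℕ → ℤ
  Lxp i n = ℓ i (M r n) (suc n)

  ℓ-M-extend : ∀ i n {B} → suc n ≤ B → ℓ i (M r n) B ≡ Lxp i n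
  ℓ-M-extend i n = ℓ-extend i (M r n) (λ _ → M-lowerTriangular)

  Lxp-zero : ∀ i → Lxp i 0 ≡ c i
  Lxp-zero i = trans (ℤ.+-identityʳ _) (trans (ℤ.*-identityˡ _) (cong c (ℕ.+-identityʳ i)))

  Lxp-one : ∀ i → Lxp i 1 ≡ Lxp (suc i) 0 - r * Lxp i 0
  Lxp-one i = trans (ℓ-linear i 2 (mulX (M r 0)) (M r 0) r M-row-one)
                    (cong₂ (λ x y → x - r * y) (ℓ-mulX i (M r 0) 1) (ℓ-M-extend i 0 {2} (s≤s z≤n)))

  Lxp-suc-suc : ∀ i n → Lxp i (suc (suc n)) ≡ Lxp (suc i) (suc n) - (r + 1ℤ) * Lxp i (suc n) - r * Lxp i n
  Lxp-suc-suc i n = begin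
    ℓ i (M r (2 +ℕ n)) (3 +ℕ n)
      ≡⟨ ℓ-linear i (3 +ℕ n) u (M r n) r (M-row-suc-suc n) ⟩
    ℓ i u (3 +ℕ n) - r * ℓ i (M r n) (3 +ℕ n)
      ≡⟨ cong₂ (λ x y → x - r * y) (ℓ-linear i (3 +ℕ n) (mulX (M r (1 +ℕ n))) (M r (1 +ℕ n)) (r + 1ℤ) (λ _ → refl))
                                   (ℓ-M-extend i n (ℕ.m≤n+m _ 2)) ⟩
    ℓ i (mulX (M r (1 +ℕ n))) (3 +ℕ n) - (r + 1ℤ) * ℓ i (M r (1 +ℕ n)) (3 +ℕ n) - r * Lxp i n
      ≡⟨ cong₂ (λ x y → x - (r + 1ℤ) * y - r * Lxp i n) (ℓ-mulX i (M r (1 +ℕ n)) (2 +ℕ n))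
               (ℓ-M-extend i (suc n) (ℕ.n≤1+n _)) ⟩
    Lxp (suc i) (suc n) - (r + 1ℤ) * Lxp i (suc n) - r * Lxp i n ∎
    where
    open ≡-Reasoning
    u : Series
    u j = mulX (M r (1 +ℕ n)) j - (r + 1ℤ) * M r (1 +ℕ n) j

  eval : Series → ℕ → ℤ
  eval H B = Σ< B (λ t → H t * r ^ t)

  eval-cong : ∀ {H} H′ B → H ≗ H′ → eval H B ≡ eval H′ B
  eval-cong H′ B H≗H′ = Σ<-cong B (λ t _ → cong (_* r ^ t) (H≗H′ t))

  eval-+ˢ : ∀ H H′ B → eval (H +ˢ H′) B ≡ eval H B + eval H′ B
  eval-+ˢ H H′ B = trans (Σ<-cong B (λ t _ → ℤ.*-distribʳ-+ (r ^ t) (H t) (H′ t)))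
                         (Σ<-distrib-+ B (λ t → H t * r ^ t) (λ t → H′ t * r ^ t))

  eval-mulX : ∀ H B → eval (mulX H) (suc B) ≡ r * eval H B
  eval-mulX H B = trans (ℤ.+-identityˡ _)
    (trans (Σ<-cong B (λ t _ → x*[r*y]≡r*[x*y] (H t) r (r ^ t))) (Σ<-distribˡ-* B r (λ t → H t * r ^ t)))
    where
    x*[r*y]≡r*[x*y] : ∀ x r y → x * (r * y) ≡ r * (x * y)
    x*[r*y]≡r*[x*y] = solve-∀

  T : ℕ → ℕ → ℤ
  T i n = eval (G i n) (3 +ℕ i)

  T-extend : ∀ i n → eval (G i n) (4 +ℕ i) ≡ T i n
  T-extend i n = Σ<-extend (λ t → G i n t * r ^ t) (λ t 3+i≤t → cong (_* r ^ t) (G-degree i n 3+i≤t)) (ℕ.n≤1+n _)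

  T-suc-zero : ∀ i → T (suc i) 0 ≡ r * (T i 0 + T i 1)
  T-suc-zero i = begin
    eval (G (suc i) 0) (4 +ℕ i)               ≡⟨ eval-cong (mulX (G i 0 +ˢ G i 1)) (4 +ℕ i) (G-suc-zero i) ⟩
    eval (mulX (G i 0 +ˢ G i 1)) (4 +ℕ i)     ≡⟨ eval-mulX (G i 0 +ˢ G i 1) (3 +ℕ i) ⟩
    r * eval (G i 0 +ˢ G i 1) (3 +ℕ i)        ≡⟨ cong (r *_) (eval-+ˢ (G i 0) (G i 1) (3 +ℕ i)) ⟩
    r * (T i 0 + T i 1)                       ∎
    where open ≡-Reasoning

  T-suc-suc : ∀ i n → T (suc i) (suc n) ≡ (T i n + T i (suc n)) + r * (T i (suc n) + T i (2 +ℕ n))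
  T-suc-suc i n = begin
    eval (G (suc i) (suc n)) (4 +ℕ i)
      ≡⟨ eval-cong ((G i n +ˢ G i (suc n)) +ˢ mulX (G i (suc n) +ˢ G i (2 +ℕ n))) (4 +ℕ i) (G-suc-suc i n) ⟩
    eval ((G i n +ˢ G i (suc n)) +ˢ mulX (G i (suc n) +ˢ G i (2 +ℕ n))) (4 +ℕ i)
      ≡⟨ eval-+ˢ (G i n +ˢ G i (suc n)) (mulX (G i (suc n) +ˢ G i (2 +ℕ n))) (4 +ℕ i) ⟩
    eval (G i n +ˢ G i (suc n)) (4 +ℕ i) + eval (mulX (G i (suc n) +ˢ G i (2 +ℕ n))) (4 +ℕ i)
      ≡⟨ cong₂ _+_ (trans (eval-+ˢ (G i n) (G i (suc n)) (4 +ℕ i)) (cong₂ _+_ (T-extend i n) (T-extend i (suc n))))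
                   (trans (eval-mulX (G i (suc n) +ˢ G i (2 +ℕ n)) (3 +ℕ i))
                          (cong (r *_) (eval-+ˢ (G i (suc n)) (G i (2 +ℕ n)) (3 +ℕ i)))) ⟩
    (T i n + T i (suc n)) + r * (T i (suc n) + T i (2 +ℕ n)) ∎
    where open ≡-Reasoning

  -- The value of Lxp i n; T i 0 is the defining sum of c (suc i).
  closedForm : ℕ → ℕ → ℤ
  closedForm zero    n = 1ˢ n
  closedForm (suc i) n = r ^ n * T i n

  T-vanishes : ∀ {i n} → suc i < n → T i n ≡ 0ℤ
  T-vanishes {i} 1+i<n = Σ<-zero (3 +ℕ i) (λ t _ → cong (_* r ^ t) (G-vanishes 1+i<n t))

  closedForm-vanishes : ∀ {i n} → i < n → closedForm i n ≡ 0ℤ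
  closedForm-vanishes {zero}  {suc n} _     = refl
  closedForm-vanishes {suc i} {n}     1+i<n = trans (cong (r ^ n *_) (T-vanishes 1+i<n)) (ℤ.*-zeroʳ (r ^ n))

  closedForm-zero : ∀ i → closedForm i 0 ≡ c i
  closedForm-zero zero    = refl
  closedForm-zero (suc i) = trans (ℤ.*-identityˡ (T i 0)) (sym (begin
    Σ< (suc i +ℕ 2) squares - Σ< (suc i +ℕ 2) products
      ≡⟨ cong (λ B → Σ< B squares - Σ< B products) (ℕ.+-comm (suc i) 2) ⟩
    Σ< (3 +ℕ i) squares - Σ< (3 +ℕ i) products
      ≡⟨ sym (Σ<-distrib-- (3 +ℕ i) squares products) ⟩
    Σ< (3 +ℕ i) (λ j → squares j - products j)
      ≡⟨ Σ<-cong (3 +ℕ i) (λ j _ → sym (distrib (choose (suc i) j) (choose i j) (choose (2 +ℕ i) j) (r ^ j))) ⟩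
    T i 0 ∎))
    where
    open ≡-Reasoning
    squares products : ℕ → ℤ
    squares  j = choose (suc i) j * choose (suc i) j * r ^ j
    products j = choose (2 +ℕ i) j * choose i j * r ^ j
    distrib : ∀ x y z p → (x * x - y * z) * p ≡ x * x * p - z * y * p
    distrib = solve-∀

  -- Stated through the unfolded form of T 0 0: normalising T 0 0 inside a larger goal is very expensive.
  T-zero-zero : T 0 0 ≡ r
  T-zero-zero = simplify r
    where
    simplify : ∀ r → 0ℤ + (1ℤ * (r * 1ℤ) + (0ℤ + 0ℤ)) ≡ r
    simplify = solve-∀

  closedForm-one : ∀ i → closedForm i 1 ≡ closedForm (suc i) 0 - r * closedForm i 0
  closedForm-one zero    = sym (trans (cong (λ z → 1ℤ * z - r * 1ℤ) T-zero-zero) (cancel r))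
    where
    cancel : ∀ r → 1ℤ * r - r * 1ℤ ≡ 0ℤ
    cancel = solve-∀
  closedForm-one (suc i) =
    trans (identity r (T i 0) (T i 1)) (cong (λ z → 1ℤ * z - r * (1ℤ * T i 0)) (sym (T-suc-zero i)))
    where
    identity : ∀ r a b → r * 1ℤ * b ≡ 1ℤ * (r * (a + b)) - r * (1ℤ * a)
    identity = solve-∀

  T-zero-one : T 0 1 ≡ 1ℤ
  T-zero-one = refl

  closedForm-suc-suc : ∀ i n → closedForm i (2 +ℕ n) ≡
    closedForm (suc i) (suc n) - (r + 1ℤ) * closedForm i (suc n) - r * closedForm i n
  closedForm-suc-suc zero zero =
    sym (trans (cong (λ z → r * 1ℤ * z - (r + 1ℤ) * 0ℤ - r * 1ℤ) T-zero-one) (identity r))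
    where
    identity : ∀ r → r * 1ℤ * 1ℤ - (r + 1ℤ) * 0ℤ - r * 1ℤ ≡ 0ℤ
    identity = solve-∀
  closedForm-suc-suc zero (suc m) = sym (trans
    (cong (λ z → r ^ (2 +ℕ m) * z - (r + 1ℤ) * 0ℤ - r * 0ℤ) (T-vanishes {0} {2 +ℕ m} (s≤s (s≤s z≤n))))
    (identity r (r ^ (2 +ℕ m))))
    where
    identity : ∀ r x → x * 0ℤ - (r + 1ℤ) * 0ℤ - r * 0ℤ ≡ 0ℤ
    identity = solve-∀
  closedForm-suc-suc (suc i) n = sym (trans
    (cong (λ z → r ^ suc n * z - (r + 1ℤ) * (r ^ suc n * T i (suc n)) - r * (r ^ n * T i n)) (T-suc-suc i n))
    (identity r (r ^ n) (T i n) (T i (suc n)) (T i (2 +ℕ n))))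
    where
    identity : ∀ r R a b d →
      r * R * ((a + b) + r * (b + d)) - (r + 1ℤ) * (r * R * b) - r * (R * a) ≡ r * (r * R) * d
    identity = solve-∀

  ThreeTermRecurrence : (ℕ → ℕ → ℤ) → Set
  ThreeTermRecurrence F =
    (∀ i → F i 1 ≡ F (suc i) 0 - r * F i 0) ×
    (∀ i n → F i (2 +ℕ n) ≡ F (suc i) (suc n) - (r + 1ℤ) * F i (suc n) - r * F i n)

  recurrence-unique : ∀ {F F′} → ThreeTermRecurrence F → ThreeTermRecurrence F′ →
    (∀ i → F i 0 ≡ F′ i 0) → ∀ i n → F i n ≡ F′ i n
  recurrence-unique {F} {F′} (F-one , F-suc-suc) (F′-one , F′-suc-suc) F₀≡F′₀ i n = proj₁ (consecutive n i)
    where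
    consecutive : ∀ n i → F i n ≡ F′ i n × F i (suc n) ≡ F′ i (suc n)
    consecutive zero    i = F₀≡F′₀ i , (begin
      F i 1                           ≡⟨ F-one i ⟩
      F (suc i) 0 - r * F i 0         ≡⟨ cong₂ (λ x y → x - r * y) (F₀≡F′₀ (suc i)) (F₀≡F′₀ i) ⟩
      F′ (suc i) 0 - r * F′ i 0       ≡⟨ sym (F′-one i) ⟩
      F′ i 1                          ∎)
      where open ≡-Reasoning
    consecutive (suc n) i = proj₂ (consecutive n i) , (begin
      F i (2 +ℕ n)
        ≡⟨ F-suc-suc i n ⟩
      F (suc i) (suc n) - (r + 1ℤ) * F i (suc n) - r * F i n
        ≡⟨ cong₂ (λ x y → x - (r + 1ℤ) * y - r * F i n) (proj₂ (consecutive n (suc i))) (proj₂ (consecutive n i)) ⟩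
      F′ (suc i) (suc n) - (r + 1ℤ) * F′ i (suc n) - r * F i n
        ≡⟨ cong (λ z → F′ (suc i) (suc n) - (r + 1ℤ) * F′ i (suc n) - r * z) (proj₁ (consecutive n i)) ⟩
      F′ (suc i) (suc n) - (r + 1ℤ) * F′ i (suc n) - r * F′ i n
        ≡⟨ sym (F′-suc-suc i n) ⟩
      F′ i (2 +ℕ n) ∎)
      where open ≡-Reasoning

  Lxp≡closedForm : ∀ i n → Lxp i n ≡ closedForm i n
  Lxp≡closedForm =
    recurrence-unique {Lxp} {closedForm} (Lxp-one , Lxp-suc-suc) (closedForm-one , closedForm-suc-suc)
    (λ i → trans (Lxp-zero i) (sym (closedForm-zero i)))

  Lxp-vanishes : ∀ {i n} → i < n → Lxp i n ≡ 0ℤ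
  Lxp-vanishes {i} {n} i<n = trans (Lxp≡closedForm i n) (closedForm-vanishes i<n)

  L-· : ∀ p q → L r (p · q) ≡ Σ< (length p +ℕ length q) (λ k → (coeff p ⊛ coeff q) k * c k)
  L-· p q = trans (cong (λ B → Σ< B (λ k → coeff (p · q) k * c k)) (length-· p q))
                  (Σ<-cong (length p +ℕ length q) (λ k k<N → cong (_* c k) (coeff-· p q k<N)))

  L-·-comm : ∀ p q → L r (p · q) ≡ L r (q · p)
  L-·-comm p q = begin
    L r (p · q)
      ≡⟨ L-· p q ⟩
    Σ< (length p +ℕ length q) (λ k → (coeff p ⊛ coeff q) k * c k)
      ≡⟨ cong (λ B → Σ< B (λ k → (coeff p ⊛ coeff q) k * c k)) (ℕ.+-comm (length p) (length q)) ⟩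
    Σ< (length q +ℕ length p) (λ k → (coeff p ⊛ coeff q) k * c k)
      ≡⟨ Σ<-cong (length q +ℕ length p) (λ k _ → cong (_* c k) (⊛-comm (coeff p) (coeff q) k)) ⟩
    Σ< (length q +ℕ length p) (λ k → (coeff q ⊛ coeff p) k * c k)
      ≡⟨ sym (L-· q p) ⟩
    L r (q · p) ∎
    where open ≡-Reasoning

  Σ<-⊛-moments : ∀ N u v → Σ< N (λ k → (u ⊛ v) k * c k) ≡ Σ< N (λ i → u i * ℓ i v (N ∸ i))
  Σ<-⊛-moments N u v = begin
    Σ< N (λ k → (u ⊛ v) k * c k)
      ≡⟨ Σ<-cong N (λ k _ → trans (sym (Σ<-distribʳ-* (suc k) (λ i → u i * v (k ∸ i)) (c k)))
                                  (Σ<-cong (suc k) (λ i i≤k → cong (λ j → u i * v (k ∸ i) * c j)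
                                                                    (sym (ℕ.m+[n∸m]≡n (ℕ.≤-pred i≤k)))))) ⟩
    Σ< N (λ k → Σ< (suc k) (λ i → F i (k ∸ i)))
      ≡⟨ Σ<-triangle N F ⟩
    Σ< N (λ i → Σ< (N ∸ i) (F i))
      ≡⟨ Σ<-cong N (λ i _ → trans (Σ<-cong (N ∸ i) (λ j _ → ℤ.*-assoc (u i) (v j) (c (i +ℕ j))))
                                  (Σ<-distribˡ-* (N ∸ i) (u i) (λ j → v j * c (i +ℕ j)))) ⟩
    Σ< N (λ i → u i * ℓ i v (N ∸ i)) ∎
    where
    open ≡-Reasoning
    F : ℕ → ℕ → ℤ
    F i j = u i * v j * c (i +ℕ j)

  M-row-orthogonal : ∀ {m n} u N → (∀ i → m < i → u i ≡ 0ℤ) → m < n → suc n +ℕ m ≤ N →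
    Σ< N (λ k → (u ⊛ M r n) k * c k) ≡ 0ℤ
  M-row-orthogonal {m} {n} u N u≡0 m<n 1+n+m≤N = trans (Σ<-⊛-moments N u (M r n)) (Σ<-zero N term≡0)
    where
    term≡0 : ∀ i → i < N → u i * ℓ i (M r n) (N ∸ i) ≡ 0ℤ
    term≡0 i _ with m ℕ.<? i
    ... | yes m<i = cong (_* ℓ i (M r n) (N ∸ i)) (u≡0 i m<i)
    ... | no  m≮i = trans (cong (u i *_) (trans (ℓ-M-extend i n 1+n≤N∸i) (Lxp-vanishes (ℕ.≤-<-trans i≤m m<n))))
                          (ℤ.*-zeroʳ (u i))
      where
      i≤m : i ≤ m
      i≤m = ℕ.≮⇒≥ m≮i
      1+n≤N∸i : suc n ≤ N ∸ i
      1+n≤N∸i = ℕ.m+n≤o⇒m≤o∸n (suc n) (ℕ.≤-trans (ℕ.+-monoʳ-≤ (suc n) i≤m) 1+n+m≤N)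

  coeff-pPoly : ∀ n → coeff (pPoly r n) ≗ M r n
  coeff-pPoly n k with k ℕ.<? suc n
  ... | yes k<1+n = coeff-applyUpTo (M r n) k<1+n
  ... | no  k≮1+n = trans (coeff-applyUpTo-≥ (M r n) (ℕ.≮⇒≥ k≮1+n)) (sym (M-lowerTriangular (ℕ.≮⇒≥ k≮1+n)))

  length-pPoly : ∀ n → length (pPoly r n) ≡ suc n
  length-pPoly n = List.length-applyUpTo (M r n) (suc n)

  pPoly-monic : ∀ n → coeff (pPoly r n) n ≡ 1ℤ
  pPoly-monic n = trans (coeff-applyUpTo (M r n) (ℕ.n<1+n n)) (M-diagonal n)

  pPoly-degree : ∀ {n k} → n < k → coeff (pPoly r n) k ≡ 0ℤ
  pPoly-degree {n} = coeff-applyUpTo-≥ (M r n)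

  L-pPoly-orthogonal-< : ∀ {m n} → m < n → L r (pPoly r m · pPoly r n) ≡ 0ℤ
  L-pPoly-orthogonal-< {m} {n} m<n = begin
    L r (pPoly r m · pPoly r n)
      ≡⟨ L-· (pPoly r m) (pPoly r n) ⟩
    Σ< (length (pPoly r m) +ℕ length (pPoly r n)) (λ k → (coeff (pPoly r m) ⊛ coeff (pPoly r n)) k * c k)
      ≡⟨ cong₂ (λ B B′ → Σ< (B +ℕ B′) (λ k → (coeff (pPoly r m) ⊛ coeff (pPoly r n)) k * c k))
               (length-pPoly m) (length-pPoly n) ⟩
    Σ< (suc m +ℕ suc n) (λ k → (coeff (pPoly r m) ⊛ coeff (pPoly r n)) k * c k)
      ≡⟨ Σ<-cong (suc m +ℕ suc n) (λ k _ → cong (_* c k) (⊛-congʳ (coeff (pPoly r m)) (coeff-pPoly n) k)) ⟩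
    Σ< (suc m +ℕ suc n) (λ k → (coeff (pPoly r m) ⊛ M r n) k * c k)
      ≡⟨ M-row-orthogonal (coeff (pPoly r m)) _ (λ _ → pPoly-degree) m<n
           (ℕ.≤-trans (ℕ.≤-reflexive (ℕ.+-comm (suc n) m)) (ℕ.n≤1+n _)) ⟩
    0ℤ ∎
    where open ≡-Reasoning

  L-pPoly-orthogonal : ∀ m n → m ≢ n → L r (pPoly r m · pPoly r n) ≡ 0ℤ
  L-pPoly-orthogonal m n m≢n with ℕ.<-cmp m n
  ... | tri< m<n _   _   = L-pPoly-orthogonal-< m<n
  ... | tri≈ _   m≡n _   = contradiction m≡n m≢n
  ... | tri> _   _   n<m = trans (L-·-comm (pPoly r m) (pPoly r n)) (L-pPoly-orthogonal-< n<m)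

mainTheorem5 : (r : ℤ) → r ≢ 0ℤ →
    ((n : ℕ) → (coeff (pPoly r n) n ≡ 1ℤ) × ((k : ℕ) → n < k → coeff (pPoly r n) k ≡ 0ℤ))
    × ((m n : ℕ) → m ≢ n → L r (pPoly r m · pPoly r n) ≡ 0ℤ)
mainTheorem5 r _ = (λ n → pPoly-monic r n , λ k → pPoly-degree r) , L-pPoly-orthogonal r
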